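{- Suppose that $\mathcal{I}_k$ is isomorphic to $\mathcal{I}(E, \mathtt{P}\theta)$, and that for all $x\in \mathit{Vars}(\mathtt{P})$, the formula $\kappa(x)$ contains knowledge operators and the branching operator $A$ only in positive position. Then $\theta$ implements the epistemic protocol specification $\langle Ags, E, \mathtt{P}, \Phi_\kappa \rangle$.
   Context: Let ${\cal S}$ be a sound local proposition epistemic protocol specification: an environment $E$, protocol templates $\mathtt{P}=\{\mathtt{P}_i\}$ of the form $\mathbf{do}~\phi_1\rightarrow a_1~[]~\ldots~[]~\phi_k\rightarrow a_k~\mathbf{od}$ with template variables $\mathit{Vars}(\mathtt{P})$, and a function $\kappa$ assigning to each template variable $x$ of agent $i$ a formula $\kappa(x)=K_i\psi$, with specification $\Phi_\kappa=\{AG(x\Rightarrow\kappa(x)) \mid x\in\mathit{Vars}(\mathtt{P})\}$. $\theta$ implements the specification if each $\theta(x)$ is a boolean formula local to the owning agent and the system $\mathcal{I}(E,\mathtt{P}\theta)$ obtained by running $\mathtt{P}\theta$ in $E$ (observational semantics for knowledge, bundle semantics for $A$) satisfies $\Phi_\kappa\theta$. Fix a total pre-order on $\mathit{Vars}(\mathtt{P})$, represented by a sequence of sets $X_1,\ldots,X_k$ (variables in earlier sets strictly precede those in later sets; variables in the same set are equivalent). Let $\mathcal{I}_0\supseteq\mathcal{I}_1\supseteq\ldots\supseteq\mathcal{I}_k$ be a sequence of interpreted systems, and let $\theta$ be a substitution consistent with this sequence, i.e., for all $i=1,\ldots,k$ and $x\in X_i$, $\mathcal{I}_{i-1}\models AG(\theta(x)\Leftrightarrow\kappa(x))$.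 -}

module Defs where

open import Data.Nat using (ℕ; zero; suc; _≤_; _<_)
open import Data.Bool using (Bool; true; false; not; _∧_; _∨_; T)
open import Data.Sum using (_⊎_; inj₁; inj₂; [_,_])
open import Data.Product using (Σ; ∃; _×_; _,_)
open import Data.List using (List)
open import Data.List.Relation.Unary.Any using (Any)
open import Data.List.Relation.Unary.All using (All)
open import Data.Unit using (⊤)
open import Data.Empty using (⊥)
open import Relation.Nullary using (¬_)
open import Relation.Binary.PropositionalEquality using (_≡_)
open import Function.Bundles using (_⇔_)

data BExp (A : Set) : Set where
  atom : A → BExp A
  btrue : BExp A
  bnot : BExp A → BExp A
  band : BExp A → BExp A → BExp A
  bor  : BExp A → BExp A → BExp A

evalB : {A : Set} → (A → Bool) → BExp A → Bool
evalB v (atom a) = v a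
evalB v btrue = true
evalB v (bnot b) = not (evalB v b)
evalB v (band b c) = evalB v b ∧ evalB v c
evalB v (bor b c) = evalB v b ∨ evalB v c

data Form (Agt Prop : Set) : Set where
  prop : Prop → Form Agt Prop
  ftrue : Form Agt Prop
  neg : Form Agt Prop → Form Agt Prop
  and : Form Agt Prop → Form Agt Prop → Form Agt Prop
  or  : Form Agt Prop → Form Agt Prop → Form Agt Prop
  imp : Form Agt Prop → Form Agt Prop → Form Agt Prop
  K   : Agt → Form Agt Prop → Form Agt Prop
  A   : Form Agt Prop → Form Agt Prop
  X   : Form Agt Prop → Form Agt Prop
  G   : Form Agt Prop → Form Agt Prop
  U   : Form Agt Prop → Form Agt Prop → Form Agt Prop

iff : {Agt Prop : Set} → Form Agt Prop → Form Agt Prop → Form Agt Prop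
iff φ ψ = and (imp φ ψ) (imp ψ φ)

AG : {Agt Prop : Set} → Form Agt Prop → Form Agt Prop
AG φ = A (G φ)

embed : {Agt Prop : Set} → BExp Prop → Form Agt Prop
embed (atom p) = prop p
embed btrue = ftrue
embed (bnot b) = neg (embed b)
embed (band b c) = and (embed b) (embed c)
embed (bor b c) = or (embed b) (embed c)

-- K and A occur only in positive position (KAPos) / only in
-- positive position of the negation (KANeg, i.e. not in negative position
-- relative to an enclosing negative context).
KAPos KANeg : {Agt Prop : Set} → Form Agt Prop → Set
KAPos (prop p) = ⊤
KAPos ftrue = ⊤
KAPos (neg φ) = KANeg φ
KAPos (and φ ψ) = KAPos φ × KAPos ψ
KAPos (or φ ψ) = KAPos φ × KAPos ψ
KAPos (imp φ ψ) = KANeg φ × KAPos ψ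
KAPos (K i φ) = KAPos φ
KAPos (A φ) = KAPos φ
KAPos (X φ) = KAPos φ
KAPos (G φ) = KAPos φ
KAPos (U φ ψ) = KAPos φ × KAPos ψ
KANeg (prop p) = ⊤
KANeg ftrue = ⊤
KANeg (neg φ) = KAPos φ
KANeg (and φ ψ) = KANeg φ × KANeg ψ
KANeg (or φ ψ) = KANeg φ × KANeg ψ
KANeg (imp φ ψ) = KAPos φ × KANeg ψ
KANeg (K i φ) = ⊥
KANeg (A φ) = ⊥
KANeg (X φ) = KANeg φ
KANeg (G φ) = KANeg φ
KANeg (U φ ψ) = KANeg φ × KANeg ψ

record Env (Agt Prop : Set) : Set₁ where
  field
    S    : Set
    Init : S → Set
    Act  : Agt → Set
    skip : (i : Agt) → Act i
    τ    : S → ((i : Agt) → Act i) → S → Set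
    Obs  : Agt → Set
    O    : (i : Agt) → S → Obs i
    π    : S → Prop → Bool

module Sem {Agt Prop : Set} (E : Env Agt Prop) where
  open Env E

  Run : Set
  Run = ℕ → S

  System : Set₁
  System = Run → Set

  -- observational semantics for K, bundle semantics for A
  sat : System → Run → ℕ → Form Agt Prop → Set
  sat R r m (prop p) = T (π (r m) p)
  sat R r m ftrue = ⊤
  sat R r m (neg φ) = ¬ sat R r m φ
  sat R r m (and φ ψ) = sat R r m φ × sat R r m ψ
  sat R r m (or φ ψ) = sat R r m φ ⊎ sat R r m ψ
  sat R r m (imp φ ψ) = sat R r m φ → sat R r m ψ
  sat R r m (K i φ) =
    ∀ r' m' → R r' → O i (r' m') ≡ O i (r m) → sat R r' m' φ
  sat R r m (A φ) =
    ∀ r' → R r' → (∀ j → j ≤ m → r' j ≡ r j) → sat R r' m φ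
  sat R r m (X φ) = sat R r (suc m) φ
  sat R r m (G φ) = ∀ n → m ≤ n → sat R r n φ
  sat R r m (U φ ψ) =
    Σ ℕ λ n → m ≤ n × sat R r n ψ × (∀ j → m ≤ j → j < n → sat R r j φ)

  Valid : System → Form Agt Prop → Set
  Valid R φ = ∀ r → R r → sat R r 0 φ

  _⊆_ : System → System → Set
  R₁ ⊆ R₂ = ∀ r → R₁ r → R₂ r

  record _≅_ (R₁ R₂ : System) : Set where
    field
      to    : ∀ r → R₁ r → Run
      to∈   : ∀ r (p : R₁ r) → R₂ (to r p)
      from  : ∀ r → R₂ r → Run
      from∈ : ∀ r (p : R₂ r) → R₁ (from r p)
      from-to : ∀ r (p : R₁ r) m → from (to r p) (to∈ r p) m ≡ r m
      to-from : ∀ r (p : R₂ r) m → to (from r p) (from∈ r p) m ≡ r m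
      val   : ∀ r (p : R₁ r) m q → π (to r p m) q ≡ π (r m) q
      obs   : ∀ i r (p : R₁ r) r' (p' : R₁ r') m m' →
              (O i (r m) ≡ O i (r' m')) ⇔ (O i (to r p m) ≡ O i (to r' p' m'))
      pref  : ∀ r (p : R₁ r) r' (p' : R₁ r') m →
              (∀ j → j ≤ m → r j ≡ r' j) ⇔ (∀ j → j ≤ m → to r p j ≡ to r' p' j)

  -- protocol templates  do g₁ → a₁ [] … [] gₖ → aₖ od  (one per agent);
  -- guards are boolean formulas over atomic propositions and template
  -- variables.
  Template : Set → Set
  Template Var = (i : Agt) → List (BExp (Prop ⊎ Var) × Act i)

  evalGuard : {Var : Set} → (Var → BExp Prop) → S → BExp (Prop ⊎ Var) → Bool
  evalGuard θ s g = evalB [ π s , (λ x → evalB (π s) (θ x)) ] g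

  Enabled : {Var : Set} → Template Var → (Var → BExp Prop) →
            (i : Agt) → S → Act i → Set
  Enabled P θ i s a =
    Any (λ c → evalGuard θ s (Data.Product.proj₁ c) ≡ true
               × Data.Product.proj₂ c ≡ a) (P i)
    ⊎ (All (λ c → evalGuard θ s (Data.Product.proj₁ c) ≡ false) (P i)
       × a ≡ skip i)

  Sys : {Var : Set} → Template Var → (Var → BExp Prop) → System
  Sys P θ r =
    Init (r 0) ×
    (∀ m → Σ ((i : Agt) → Act i) λ a →
             (∀ i → Enabled P θ i (r m) (a i)) × τ (r m) a (r (suc m)))

  Local : System → Agt → BExp Prop → Set
  Local R i φ = ∀ r r' m m' → R r → R r' → O i (r m) ≡ O i (r' m') →
                evalB (π (r m)) φ ≡ evalB (π (r' m')) φ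

  κ : {Var : Set} → (Var → Agt) → (Var → Form Agt Prop) → Var → Form Agt Prop
  κ owner ψ x = K (owner x) (ψ x)

  Implements : {Var : Set} → (Var → Agt) → Template Var →
               (Var → Form Agt Prop) → (Var → BExp Prop) → Set
  Implements owner P ψ θ =
    (∀ x → Local (Sys P θ) (owner x) (θ x)) ×
    (∀ x → Valid (Sys P θ) (AG (imp (embed (θ x)) (κ owner ψ x))))

module Submission where

-- Write Iₖ for the last (smallest) system of the chain
-- I₀ ⊇ … ⊇ Iₖ.  For a template variable x of rank j, consistency says that
-- θ(x) ⇔ κ(x) holds everywhere in I_j ⊇ Iₖ.  Two facts about Iₖ follow:
--   * θ(x) is local to the owner i of x in I_j, because a boolean formula
--     equivalent to a formula K_i ψ is constant along i-indistinguishable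
--     points; locality then restricts to the subsystem Iₖ.
--   * θ(x) ⇒ κ(x) holds everywhere in Iₖ: this formula has K and A only in
--     positive position (θ(x) is boolean and κ(x) is positive), and such
--     formulas survive the passage from a system to a subsystem.
-- Finally both properties are invariant under isomorphism of interpreted
-- systems, so they carry over from Iₖ to I(E, Pθ), which is exactly the
-- statement that θ implements the specification.

open import Defs
open import Data.Nat using (ℕ; zero; suc; z≤n)
open import Data.Fin using (Fin; inject₁; fromℕ)
open import Data.Bool using (Bool; true; false; not; _∧_; _∨_; T)
open import Data.Bool.Properties using (T-∧; T-∨)
open import Data.Sum using (inj₁; inj₂)
open import Data.Product using (∃; _,_; proj₁; proj₂)
open import Data.Unit using (tt)
open import Relation.Nullary using (¬_)
open import Relation.Binary.PropositionalEquality
  using (_≡_; refl; sym; trans; cong; cong₂; subst; module ≡-Reasoning)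
open import Function.Bundles using (_⇔_; mk⇔; Equivalence)

open Equivalence using (to; from)

T-not : ∀ b → T (not b) ⇔ (¬ T b)
T-not true  = mk⇔ (λ ()) (λ ¬t → ¬t tt)
T-not false = mk⇔ (λ _ ()) (λ _ → tt)

T-ext : ∀ {b c} → (T b → T c) → (T c → T b) → b ≡ c
T-ext {true}  {true}  _ _ = refl
T-ext {true}  {false} f _ with f tt
... | ()
T-ext {false} {true}  _ g with g tt
... | ()
T-ext {false} {false} _ _ = refl

evalB-cong : {Atom : Set} {v w : Atom → Bool} → (∀ a → v a ≡ w a) →
             ∀ b → evalB v b ≡ evalB w b
evalB-cong v≗w (atom a)   = v≗w a
evalB-cong v≗w btrue      = refl
evalB-cong v≗w (bnot b)   = cong not (evalB-cong v≗w b)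
evalB-cong v≗w (band b c) = cong₂ _∧_ (evalB-cong v≗w b) (evalB-cong v≗w c)
evalB-cong v≗w (bor b c)  = cong₂ _∨_ (evalB-cong v≗w b) (evalB-cong v≗w c)

embed-KAPos : {Agt Prop : Set} (b : BExp Prop) → KAPos {Agt} (embed b)
embed-KANeg : {Agt Prop : Set} (b : BExp Prop) → KANeg {Agt} (embed b)
embed-KAPos (atom a)   = tt
embed-KAPos btrue      = tt
embed-KAPos (bnot b)   = embed-KANeg b
embed-KAPos (band b c) = embed-KAPos b , embed-KAPos c
embed-KAPos (bor b c)  = embed-KAPos b , embed-KAPos c
embed-KANeg (atom a)   = tt
embed-KANeg btrue      = tt
embed-KANeg (bnot b)   = embed-KAPos b
embed-KANeg (band b c) = embed-KANeg b , embed-KANeg c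
embed-KANeg (bor b c)  = embed-KANeg b , embed-KANeg c

module Properties {Agt Prop : Set} (E : Env Agt Prop) where
  open Env E
  open Sem E

  -- φ holds at every point (r, n) of R; a record rather than a function
  -- type so that R and φ can be inferred from it.
  record Everywhere (R : System) (φ : Form Agt Prop) : Set where
    constructor everywhere
    field at : ∀ r → R r → ∀ n → sat R r n φ
  open Everywhere public

  AG-valid⇒everywhere : ∀ {R φ} → Valid R (AG φ) → Everywhere R φ
  AG-valid⇒everywhere valid = everywhere λ r r∈R n → valid r r∈R r r∈R (λ _ _ → refl) n z≤n

  everywhere⇒AG-valid : ∀ {R φ} → Everywhere R φ → Valid R (AG φ)
  everywhere⇒AG-valid all r _ r' r'∈R _ n _ = at all r' r'∈R n

  sat-pointwise : ∀ R {r r'} → (∀ j → r j ≡ r' j) →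
                  ∀ m φ → sat R r m φ → sat R r' m φ
  sat-pointwise R r≗r' m (prop p) h = subst (λ s → T (π s p)) (r≗r' m) h
  sat-pointwise R r≗r' m ftrue h = h
  sat-pointwise R r≗r' m (neg φ) h =
    λ h' → h (sat-pointwise R (λ j → sym (r≗r' j)) m φ h')
  sat-pointwise R r≗r' m (and φ ψ) (hφ , hψ) =
    sat-pointwise R r≗r' m φ hφ , sat-pointwise R r≗r' m ψ hψ
  sat-pointwise R r≗r' m (or φ ψ) (inj₁ hφ) = inj₁ (sat-pointwise R r≗r' m φ hφ)
  sat-pointwise R r≗r' m (or φ ψ) (inj₂ hψ) = inj₂ (sat-pointwise R r≗r' m ψ hψ)
  sat-pointwise R r≗r' m (imp φ ψ) h =
    λ h' → sat-pointwise R r≗r' m ψ (h (sat-pointwise R (λ j → sym (r≗r' j)) m φ h'))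
  sat-pointwise R r≗r' m (K i φ) h =
    λ r'' m'' r''∈R o → h r'' m'' r''∈R (trans o (cong (O i) (sym (r≗r' m))))
  sat-pointwise R r≗r' m (A φ) h =
    λ r'' r''∈R pre → h r'' r''∈R (λ j j≤m → trans (pre j j≤m) (sym (r≗r' j)))
  sat-pointwise R r≗r' m (X φ) h = sat-pointwise R r≗r' (suc m) φ h
  sat-pointwise R r≗r' m (G φ) h = λ n m≤n → sat-pointwise R r≗r' n φ (h n m≤n)
  sat-pointwise R r≗r' m (U φ ψ) (n , m≤n , hψ , hφ) =
    n , m≤n , sat-pointwise R r≗r' n ψ hψ ,
    λ j m≤j j<n → sat-pointwise R r≗r' j φ (hφ j m≤j j<n)

  sat-embed : ∀ R r m (b : BExp Prop) →
              sat R r m (embed b) ⇔ T (evalB (π (r m)) b)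
  sat-embed R r m (atom a) = mk⇔ (λ t → t) (λ t → t)
  sat-embed R r m btrue    = mk⇔ (λ _ → tt) (λ _ → tt)
  sat-embed R r m (bnot b) =
    mk⇔ (λ ¬s → from (T-not _) (λ t → ¬s (from (sat-embed R r m b) t)))
        (λ t s → to (T-not _) t (to (sat-embed R r m b) s))
  sat-embed R r m (band b c) =
    mk⇔ (λ (sb , sc) → from T-∧ (to (sat-embed R r m b) sb , to (sat-embed R r m c) sc))
        (λ t → let (tb , tc) = to T-∧ t
               in from (sat-embed R r m b) tb , from (sat-embed R r m c) tc)
  sat-embed R r m (bor b c) = mk⇔ there back
    where
    there : sat R r m (embed (bor b c)) → T (evalB (π (r m)) (bor b c))
    there (inj₁ sb) = from T-∨ (inj₁ (to (sat-embed R r m b) sb))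
    there (inj₂ sc) = from (T-∨ {evalB (π (r m)) b}) (inj₂ (to (sat-embed R r m c) sc))
    back : T (evalB (π (r m)) (bor b c)) → sat R r m (embed (bor b c))
    back t with to (T-∨ {evalB (π (r m)) b}) t
    ... | inj₁ tb = inj₁ (from (sat-embed R r m b) tb)
    ... | inj₂ tc = inj₂ (from (sat-embed R r m c) tc)

  sat-shrink : ∀ {R R'} → R' ⊆ R → ∀ r → R' r → ∀ m φ → KAPos φ →
               sat R r m φ → sat R' r m φ
  sat-grow   : ∀ {R R'} → R' ⊆ R → ∀ r → R' r → ∀ m φ → KANeg φ →
               sat R' r m φ → sat R r m φ
  sat-shrink ⊆R r r∈ m (prop p) _ h = h
  sat-shrink ⊆R r r∈ m ftrue _ h = h
  sat-shrink ⊆R r r∈ m (neg φ) nφ h = λ h' → h (sat-grow ⊆R r r∈ m φ nφ h')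
  sat-shrink ⊆R r r∈ m (and φ ψ) (pφ , pψ) (hφ , hψ) =
    sat-shrink ⊆R r r∈ m φ pφ hφ , sat-shrink ⊆R r r∈ m ψ pψ hψ
  sat-shrink ⊆R r r∈ m (or φ ψ) (pφ , _) (inj₁ hφ) = inj₁ (sat-shrink ⊆R r r∈ m φ pφ hφ)
  sat-shrink ⊆R r r∈ m (or φ ψ) (_ , pψ) (inj₂ hψ) = inj₂ (sat-shrink ⊆R r r∈ m ψ pψ hψ)
  sat-shrink ⊆R r r∈ m (imp φ ψ) (nφ , pψ) h =
    λ h' → sat-shrink ⊆R r r∈ m ψ pψ (h (sat-grow ⊆R r r∈ m φ nφ h'))
  sat-shrink ⊆R r r∈ m (K i φ) pos h =
    λ r' m' r'∈ o → sat-shrink ⊆R r' r'∈ m' φ pos (h r' m' (⊆R r' r'∈) o)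
  sat-shrink ⊆R r r∈ m (A φ) pos h =
    λ r' r'∈ pre → sat-shrink ⊆R r' r'∈ m φ pos (h r' (⊆R r' r'∈) pre)
  sat-shrink ⊆R r r∈ m (X φ) pos h = sat-shrink ⊆R r r∈ (suc m) φ pos h
  sat-shrink ⊆R r r∈ m (G φ) pos h = λ n m≤n → sat-shrink ⊆R r r∈ n φ pos (h n m≤n)
  sat-shrink ⊆R r r∈ m (U φ ψ) (pφ , pψ) (n , m≤n , hψ , hφ) =
    n , m≤n , sat-shrink ⊆R r r∈ n ψ pψ hψ ,
    λ j m≤j j<n → sat-shrink ⊆R r r∈ j φ pφ (hφ j m≤j j<n)
  sat-grow ⊆R r r∈ m (prop p) _ h = h
  sat-grow ⊆R r r∈ m ftrue _ h = h
  sat-grow ⊆R r r∈ m (neg φ) pφ h = λ h' → h (sat-shrink ⊆R r r∈ m φ pφ h')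
  sat-grow ⊆R r r∈ m (and φ ψ) (nφ , nψ) (hφ , hψ) =
    sat-grow ⊆R r r∈ m φ nφ hφ , sat-grow ⊆R r r∈ m ψ nψ hψ
  sat-grow ⊆R r r∈ m (or φ ψ) (nφ , _) (inj₁ hφ) = inj₁ (sat-grow ⊆R r r∈ m φ nφ hφ)
  sat-grow ⊆R r r∈ m (or φ ψ) (_ , nψ) (inj₂ hψ) = inj₂ (sat-grow ⊆R r r∈ m ψ nψ hψ)
  sat-grow ⊆R r r∈ m (imp φ ψ) (pφ , nψ) h =
    λ h' → sat-grow ⊆R r r∈ m ψ nψ (h (sat-shrink ⊆R r r∈ m φ pφ h'))
  sat-grow ⊆R r r∈ m (K i φ) () h
  sat-grow ⊆R r r∈ m (A φ) () h
  sat-grow ⊆R r r∈ m (X φ) nφ h = sat-grow ⊆R r r∈ (suc m) φ nφ h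
  sat-grow ⊆R r r∈ m (G φ) nφ h = λ n m≤n → sat-grow ⊆R r r∈ n φ nφ (h n m≤n)
  sat-grow ⊆R r r∈ m (U φ ψ) (nφ , nψ) (n , m≤n , hψ , hφ) =
    n , m≤n , sat-grow ⊆R r r∈ n ψ nψ hψ ,
    λ j m≤j j<n → sat-grow ⊆R r r∈ j φ nφ (hφ j m≤j j<n)

  everywhere-⊆ : ∀ {R R' φ} → R' ⊆ R → KAPos φ → Everywhere R φ → Everywhere R' φ
  everywhere-⊆ {φ = φ} ⊆R pos all =
    everywhere λ r r∈ n → sat-shrink ⊆R r r∈ n φ pos (at all r (⊆R r r∈) n)

  -- A boolean formula that is everywhere equivalent to a formula K_i φ is
  -- local to agent i: both are constant along i-indistinguishable points.
  knowledge-local : ∀ {R i φ} (b : BExp Prop) →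
                    Everywhere R (iff (embed b) (K i φ)) → Local R i b
  knowledge-local {R} {i} b b⇔K r r' m m' r∈ r'∈ o =
    T-ext (transport r r' m m' r∈ r'∈ o) (transport r' r m' m r'∈ r∈ (sym o))
    where
    transport : ∀ s s' n n' → R s → R s' → O i (s n) ≡ O i (s' n') →
                T (evalB (π (s n)) b) → T (evalB (π (s' n')) b)
    transport s s' n n' s∈ s'∈ o t =
      to (sat-embed R s' n' b)
         (proj₂ (at b⇔K s' s'∈ n')
           (λ s'' n'' s''∈ o'' → proj₁ (at b⇔K s s∈ n) (from (sat-embed R s n b) t)
                                   s'' n'' s''∈ (trans o'' (sym o))))

  local-⊆ : ∀ {R R' i b} → R' ⊆ R → Local R i b → Local R' i b
  local-⊆ ⊆R loc r r' m m' r∈ r'∈ = loc r r' m m' (⊆R r r∈) (⊆R r' r'∈)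

  last-⊆ : ∀ k (I : Fin (suc k) → System) →
           (∀ (j : Fin k) → I (Fin.suc j) ⊆ I (inject₁ j)) →
           ∀ j → I (fromℕ k) ⊆ I j
  last-⊆ zero    I decr Fin.zero    = λ r r∈ → r∈
  last-⊆ (suc k) I decr Fin.zero    =
    λ r r∈ → decr Fin.zero r (last-⊆ k (λ j → I (Fin.suc j)) (λ j → decr (Fin.suc j)) Fin.zero r r∈)
  last-⊆ (suc k) I decr (Fin.suc j) = last-⊆ k (λ j → I (Fin.suc j)) (λ j → decr (Fin.suc j)) j

  module Transfer {R₁ R₂ : System} (iso : R₁ ≅ R₂) where
    open _≅_ iso renaming (to to iso-to; from to iso-from; to-from to round-trip)

    sat-to   : ∀ r (r∈ : R₁ r) m φ → sat R₁ r m φ → sat R₂ (iso-to r r∈) m φ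
    sat-from : ∀ r (r∈ : R₁ r) m φ → sat R₂ (iso-to r r∈) m φ → sat R₁ r m φ
    sat-to r r∈ m (prop q) h = subst T (sym (val r r∈ m q)) h
    sat-to r r∈ m ftrue h = h
    sat-to r r∈ m (neg φ) h = λ h' → h (sat-from r r∈ m φ h')
    sat-to r r∈ m (and φ ψ) (hφ , hψ) = sat-to r r∈ m φ hφ , sat-to r r∈ m ψ hψ
    sat-to r r∈ m (or φ ψ) (inj₁ hφ) = inj₁ (sat-to r r∈ m φ hφ)
    sat-to r r∈ m (or φ ψ) (inj₂ hψ) = inj₂ (sat-to r r∈ m ψ hψ)
    sat-to r r∈ m (imp φ ψ) h = λ h' → sat-to r r∈ m ψ (h (sat-from r r∈ m φ h'))
    sat-to r r∈ m (K i φ) h = λ r₂ m' r₂∈ o →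
      let s = iso-from r₂ r₂∈ ; s∈ = from∈ r₂ r₂∈
          o₁ = Equivalence.from (obs i s s∈ r r∈ m' m)
                 (trans (cong (O i) (round-trip r₂ r₂∈ m')) o)
      in sat-pointwise R₂ (round-trip r₂ r₂∈) m' φ (sat-to s s∈ m' φ (h s m' s∈ o₁))
    sat-to r r∈ m (A φ) h = λ r₂ r₂∈ pre →
      let s = iso-from r₂ r₂∈ ; s∈ = from∈ r₂ r₂∈
          pre₁ = Equivalence.from (pref s s∈ r r∈ m)
                   (λ j j≤m → trans (round-trip r₂ r₂∈ j) (pre j j≤m))
      in sat-pointwise R₂ (round-trip r₂ r₂∈) m φ (sat-to s s∈ m φ (h s s∈ pre₁))
    sat-to r r∈ m (X φ) h = sat-to r r∈ (suc m) φ h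
    sat-to r r∈ m (G φ) h = λ n m≤n → sat-to r r∈ n φ (h n m≤n)
    sat-to r r∈ m (U φ ψ) (n , m≤n , hψ , hφ) =
      n , m≤n , sat-to r r∈ n ψ hψ , λ j m≤j j<n → sat-to r r∈ j φ (hφ j m≤j j<n)
    sat-from r r∈ m (prop q) h = subst T (val r r∈ m q) h
    sat-from r r∈ m ftrue h = h
    sat-from r r∈ m (neg φ) h = λ h' → h (sat-to r r∈ m φ h')
    sat-from r r∈ m (and φ ψ) (hφ , hψ) = sat-from r r∈ m φ hφ , sat-from r r∈ m ψ hψ
    sat-from r r∈ m (or φ ψ) (inj₁ hφ) = inj₁ (sat-from r r∈ m φ hφ)
    sat-from r r∈ m (or φ ψ) (inj₂ hψ) = inj₂ (sat-from r r∈ m ψ hψ)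
    sat-from r r∈ m (imp φ ψ) h = λ h' → sat-from r r∈ m ψ (h (sat-to r r∈ m φ h'))
    sat-from r r∈ m (K i φ) h = λ r' m' r'∈ o →
      sat-from r' r'∈ m' φ
        (h (iso-to r' r'∈) m' (to∈ r' r'∈) (Equivalence.to (obs i r' r'∈ r r∈ m' m) o))
    sat-from r r∈ m (A φ) h = λ r' r'∈ pre →
      sat-from r' r'∈ m φ
        (h (iso-to r' r'∈) (to∈ r' r'∈) (Equivalence.to (pref r' r'∈ r r∈ m) pre))
    sat-from r r∈ m (X φ) h = sat-from r r∈ (suc m) φ h
    sat-from r r∈ m (G φ) h = λ n m≤n → sat-from r r∈ n φ (h n m≤n)
    sat-from r r∈ m (U φ ψ) (n , m≤n , hψ , hφ) =
      n , m≤n , sat-from r r∈ n ψ hψ , λ j m≤j j<n → sat-from r r∈ j φ (hφ j m≤j j<n)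

    everywhere-≅ : ∀ {φ} → Everywhere R₁ φ → Everywhere R₂ φ
    everywhere-≅ {φ} all = everywhere λ r r∈ n →
      sat-pointwise R₂ (round-trip r r∈) n φ
        (sat-to (iso-from r r∈) (from∈ r r∈) n φ (at all _ (from∈ r r∈) n))

    evalB-to : ∀ r (r∈ : R₂ r) m b →
               evalB (π (iso-from r r∈ m)) b ≡ evalB (π (r m)) b
    evalB-to r r∈ m b = begin
      evalB (π (iso-from r r∈ m)) b
        ≡⟨ evalB-cong (λ q → sym (val _ (from∈ r r∈) m q)) b ⟩
      evalB (π (iso-to (iso-from r r∈) (from∈ r r∈) m)) b
        ≡⟨ cong (λ s → evalB (π s) b) (round-trip r r∈ m) ⟩
      evalB (π (r m)) b ∎
      where open ≡-Reasoning

    local-≅ : ∀ {i b} → Local R₁ i b → Local R₂ i b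
    local-≅ {i} {b} loc r r' m m' r∈ r'∈ o = begin
      evalB (π (r m)) b                            ≡⟨ sym (evalB-to r r∈ m b) ⟩
      evalB (π (iso-from r r∈ m)) b                ≡⟨ loc _ _ m m' (from∈ r r∈) (from∈ r' r'∈) o₁ ⟩
      evalB (π (iso-from r' r'∈ m')) b             ≡⟨ evalB-to r' r'∈ m' b ⟩
      evalB (π (r' m')) b ∎
      where
      open ≡-Reasoning
      o₁ : O i (iso-from r r∈ m) ≡ O i (iso-from r' r'∈ m')
      o₁ = Equivalence.from (obs i _ (from∈ r r∈) _ (from∈ r' r'∈) m m')
             (trans (cong (O i) (round-trip r r∈ m))
                    (trans o (cong (O i) (sym (round-trip r' r'∈ m')))))

proposition1 : {Agt Prop : Set} (E : Env Agt Prop)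
    (Var : Set) (owner : Var → Agt) (P : Sem.Template E Var)
    (ψ : Var → Form Agt Prop)
    (k : ℕ) (rank : Var → Fin k) (rank-onto : ∀ j → ∃ λ x → rank x ≡ j)
    (I : Fin (suc k) → Sem.System E)
    (decr : ∀ (j : Fin k) → Sem._⊆_ E (I (Fin.suc j)) (I (inject₁ j)))
    (θ : Var → BExp Prop)
    (consistent : ∀ x → Sem.Valid E (I (inject₁ (rank x)))
                          (AG (iff (embed (θ x)) (Sem.κ E owner ψ x))))
    → Sem._≅_ E (I (fromℕ k)) (Sem.Sys E P θ)
    → (∀ x → KAPos (Sem.κ E owner ψ x))
    → Sem.Implements E owner P ψ θ
proposition1 E _ owner P ψ k rank _ I decr θ consistent iso positive =
  local , valid
  where
  open Sem E
  open Properties E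
  open Transfer iso

  Iₖ⊆ : ∀ x → I (fromℕ k) ⊆ I (inject₁ (rank x))
  Iₖ⊆ x = last-⊆ k I decr (inject₁ (rank x))

  θ⇔κ : ∀ x → Everywhere (I (inject₁ (rank x))) (iff (embed (θ x)) (κ owner ψ x))
  θ⇔κ x = AG-valid⇒everywhere (consistent x)

  local : ∀ x → Local (Sys P θ) (owner x) (θ x)
  local x = local-≅ {b = θ x} (local-⊆ {b = θ x} (Iₖ⊆ x) (knowledge-local (θ x) (θ⇔κ x)))

  -- θ(x) ⇒ κ(x) is positive, so it descends from I_(rank x) to Iₖ
  θ⇒κ : ∀ x → Everywhere (I (fromℕ k)) (imp (embed (θ x)) (κ owner ψ x))
  θ⇒κ x = everywhere-⊆ (Iₖ⊆ x) (embed-KANeg (θ x) , positive x)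
            (everywhere λ r r∈ n → proj₁ (at (θ⇔κ x) r r∈ n))

  valid : ∀ x → Valid (Sys P θ) (AG (imp (embed (θ x)) (κ owner ψ x)))
  valid x = everywhere⇒AG-valid (everywhere-≅ (θ⇒κ x))
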